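{- Let $(A,\rightarrow,\rightsquigarrow,1)$ be a pseudo BCK-algebra and $D\subseteq A$. Then $D$ is a commutative deductive system of $A$ if and only if for all $x,y,z\in A$: (1) $1\in D$; (2) $z\rightarrow(y\rightarrow x)\in D$ and $z\in D$ imply $((x\rightarrow y)\rightsquigarrow y)\rightarrow x\in D$; (3) $z\rightsquigarrow(y\rightsquigarrow x)\in D$ and $z\in D$ imply $((x\rightsquigarrow y)\rightarrow y)\rightsquigarrow x\in D$.
   Context: A pseudo BCK-algebra is an algebra $(A,\rightarrow,\rightsquigarrow,1)$ of type $(2,2,0)$ such that for all $x,y,z\in A$: $(x\rightarrow y)\rightsquigarrow[(y\rightarrow z)\rightsquigarrow(x\rightarrow z)]=1$; $(x\rightsquigarrow y)\rightarrow[(y\rightsquigarrow z)\rightarrow(x\rightsquigarrow z)]=1$; $1\rightarrow x=x$; $1\rightsquigarrow x=x$; $x\rightarrow 1=1$; and if $x\rightarrow y=1$ and $y\rightarrow x=1$ then $x=y$. A deductive system of $A$ is a subset $D$ with $1\in D$ such that $x\in D$ and $x\rightarrow y\in D$ imply $y\in D$ (equivalently, $x\in D$ and $x\rightsquigarrow y\in D$ imply $y\in D$). It is commutative if for all $x,y$: $y\rightarrow x\in D$ implies $((x\rightarrow y)\rightsquigarrow y)\rightarrow x\in D$, and $y\rightsquigarrow x\in D$ implies $((x\rightsquigarrow y)\rightarrow y)\rightsquigarrow x\in D$. -}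

module Defs where

open import Level using (Level; suc; _⊔_)
open import Relation.Binary.PropositionalEquality using (_≡_)
open import Relation.Unary using (Pred; _∈_)
open import Data.Product using (_×_)

record PseudoBCK (a : Level) : Set (suc a) where
  infixr 5 _⇒_ _⇝_
  field
    Carrier : Set a
    _⇒_     : Carrier → Carrier → Carrier
    _⇝_     : Carrier → Carrier → Carrier
    𝟙       : Carrier
    ax1 : ∀ x y z → (x ⇒ y) ⇝ ((y ⇒ z) ⇝ (x ⇒ z)) ≡ 𝟙
    ax2 : ∀ x y z → (x ⇝ y) ⇒ ((y ⇝ z) ⇒ (x ⇝ z)) ≡ 𝟙
    ax3 : ∀ x → 𝟙 ⇒ x ≡ x
    ax4 : ∀ x → 𝟙 ⇝ x ≡ x
    ax5 : ∀ x → x ⇒ 𝟙 ≡ 𝟙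
    ax6 : ∀ x y → x ⇒ y ≡ 𝟙 → y ⇒ x ≡ 𝟙 → x ≡ y

module _ {a ℓ : Level} (A : PseudoBCK a) where
  open PseudoBCK A

  record IsDeductiveSystem (D : Pred Carrier ℓ) : Set (a ⊔ ℓ) where
    field
      one∈ : 𝟙 ∈ D
      mp   : ∀ {x y} → x ∈ D → (x ⇒ y) ∈ D → y ∈ D

  record IsCommutativeDS (D : Pred Carrier ℓ) : Set (a ⊔ ℓ) where
    field
      isDS  : IsDeductiveSystem D
      comm⇒ : ∀ {x y} → (y ⇒ x) ∈ D → (((x ⇒ y) ⇝ y) ⇒ x) ∈ D
      comm⇝ : ∀ {x y} → (y ⇝ x) ∈ D → (((x ⇝ y) ⇒ y) ⇝ x) ∈ D

-- Commutativity with z = 1 gives back the defining implications, while the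
-- modus ponens rule of a deductive system is recovered from condition (2)
-- with y = 1, because ((x → 1) ⇝ 1) → x = x.
module Submission where

open import Defs
open import Level using (Level; _⊔_)
open import Data.Product using (_×_; _,_)
open import Function.Bundles using (_⇔_; mk⇔)
open import Relation.Unary using (Pred; _∈_)
open import Relation.Binary.PropositionalEquality
  using (_≡_; subst; sym; cong; cong₂)
open Relation.Binary.PropositionalEquality.≡-Reasoning

module PseudoBCKProperties {a : Level} (A : PseudoBCK a) where
  open PseudoBCK A

  x⇒[x⇝y]⇒y≡𝟙 : ∀ x y → x ⇒ ((x ⇝ y) ⇒ y) ≡ 𝟙
  x⇒[x⇝y]⇒y≡𝟙 x y = begin
    x ⇒ ((x ⇝ y) ⇒ y)               ≡⟨ cong₂ (λ u v → u ⇒ ((x ⇝ y) ⇒ v)) (sym (ax4 x)) (sym (ax4 y)) ⟩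
    (𝟙 ⇝ x) ⇒ ((x ⇝ y) ⇒ (𝟙 ⇝ y))   ≡⟨ ax2 𝟙 x y ⟩
    𝟙                               ∎

  [[x⇒𝟙]⇝𝟙]⇒x≡x : ∀ x → ((x ⇒ 𝟙) ⇝ 𝟙) ⇒ x ≡ x
  [[x⇒𝟙]⇝𝟙]⇒x≡x x = begin
    ((x ⇒ 𝟙) ⇝ 𝟙) ⇒ x   ≡⟨ cong (λ t → (t ⇝ 𝟙) ⇒ x) (ax5 x) ⟩
    (𝟙 ⇝ 𝟙) ⇒ x         ≡⟨ cong (_⇒ x) (ax4 𝟙) ⟩
    𝟙 ⇒ x               ≡⟨ ax3 x ⟩
    x                   ∎

module DeductiveSystemProperties {a ℓ : Level} (A : PseudoBCK a) {D : Pred (PseudoBCK.Carrier A) ℓ}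
                                 (isDS : IsDeductiveSystem {ℓ = ℓ} A D) where
  open PseudoBCK A
  open PseudoBCKProperties A
  open IsDeductiveSystem isDS

  mp⇝ : ∀ {x y} → x ∈ D → (x ⇝ y) ∈ D → y ∈ D
  mp⇝ {x} {y} x∈D x⇝y∈D = mp x⇝y∈D (mp x∈D (subst D (sym (x⇒[x⇝y]⇒y≡𝟙 x y)) one∈))

module _ {a ℓ : Level} (A : PseudoBCK a) (D : Pred (PseudoBCK.Carrier A) ℓ) where
  open PseudoBCK A
  open PseudoBCKProperties A

  CommutativeDSConditions : Set (a ⊔ ℓ)
  CommutativeDSConditions =
      (𝟙 ∈ D)
    × (∀ x y z → (z ⇒ (y ⇒ x)) ∈ D → z ∈ D → (((x ⇒ y) ⇝ y) ⇒ x) ∈ D)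
    × (∀ x y z → (z ⇝ (y ⇝ x)) ∈ D → z ∈ D → (((x ⇝ y) ⇒ y) ⇝ x) ∈ D)

  commutativeDS⇒conditions : IsCommutativeDS {ℓ = ℓ} A D → CommutativeDSConditions
  commutativeDS⇒conditions isCDS =
      one∈
    , (λ x y z z⇒y⇒x∈D z∈D → comm⇒ (mp z∈D z⇒y⇒x∈D))
    , (λ x y z z⇝y⇝x∈D z∈D → comm⇝ (mp⇝ z∈D z⇝y⇝x∈D))
    where
    open IsCommutativeDS isCDS
    open IsDeductiveSystem isDS
    open DeductiveSystemProperties A isDS

  conditions⇒commutativeDS : CommutativeDSConditions → IsCommutativeDS {ℓ = ℓ} A D
  conditions⇒commutativeDS (𝟙∈D , cond⇒ , cond⇝) = record
    { isDS  = record { one∈ = 𝟙∈D ; mp = mp }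
    ; comm⇒ = λ {x} {y} y⇒x∈D → cond⇒ x y 𝟙 (subst D (sym (ax3 (y ⇒ x))) y⇒x∈D) 𝟙∈D
    ; comm⇝ = λ {x} {y} y⇝x∈D → cond⇝ x y 𝟙 (subst D (sym (ax4 (y ⇝ x))) y⇝x∈D) 𝟙∈D
    }
    where
    mp : ∀ {x y} → x ∈ D → (x ⇒ y) ∈ D → y ∈ D
    mp {x} {y} x∈D x⇒y∈D =
      subst D ([[x⇒𝟙]⇝𝟙]⇒x≡x y)
        (cond⇒ y 𝟙 x (subst D (cong (x ⇒_) (sym (ax3 y))) x⇒y∈D) x∈D)

proposition4p2 : {a ℓ : Level} (A : PseudoBCK a) (D : Pred (PseudoBCK.Carrier A) ℓ) →
    IsCommutativeDS {ℓ = ℓ} A D ⇔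
      ( (PseudoBCK.𝟙 A ∈ D)
      × (∀ x y z → PseudoBCK._⇒_ A z (PseudoBCK._⇒_ A y x) ∈ D → z ∈ D →
           PseudoBCK._⇒_ A (PseudoBCK._⇝_ A (PseudoBCK._⇒_ A x y) y) x ∈ D)
      × (∀ x y z → PseudoBCK._⇝_ A z (PseudoBCK._⇝_ A y x) ∈ D → z ∈ D →
           PseudoBCK._⇝_ A (PseudoBCK._⇒_ A (PseudoBCK._⇝_ A x y) y) x ∈ D) )
proposition4p2 A D = mk⇔ (commutativeDS⇒conditions A D) (conditions⇒commutativeDS A D)
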